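{- Let $k\ge 5$ and let $(X,\mathcal{B})$ be a $(v,k,4,6)$ cover. For every $x\in X$ put $\mathcal{B}(x)=\{B\setminus\{x\} : B\in\mathcal{B},\ x\in B\}$, and choose $a\in X$ with $|\mathcal{B}(a)|\le|\mathcal{B}(x)|$ for all $x\in X$. Let $b,c,d$ be three new points not in $X$. Let $X_{1,1},X_{1,2},X_{2,1},X_{2,2},X_{3,1},X_{3,2}$ be a partition of $X\setminus\{a\}$. Take covering designs with $t=2$ as follows: $(X_{1,1}\cup X_{2,1},\mathcal{C}_1)$, $(X_{1,2}\cup X_{2,2},\mathcal{C}_2)$, $(X_{3,1}\cup X_{3,2},\mathcal{C}_3)$ with block size $k-3$; $(X_{1,1}\cup X_{2,2},\mathcal{D}_1)$, $(X_{1,2}\cup X_{2,1},\mathcal{D}_2)$, $(X_{3,1}\cup X_{3,2},\mathcal{D}_3)$ with block size $k-3$; and $(X_{1,1}\cup X_{1,2},\mathcal{E}_1)$, $(X_{2,1}\cup X_{2,2},\mathcal{E}_2)$, $(X_{3,1}\cup X_{3,2},\mathcal{E}_3)$ with block size $k-2$ (each is a covering design in which every pair of points of its point set lies in some block). Define $\mathcal{B}_1=\mathcal{B}$; $\mathcal{B}_2=\{B\cup\{p\}: B\in\mathcal{B}(a),\ p\in\{b,c,d\}\}$; $\mathcal{B}_3=\{C\cup\{a,b,c\}: C\in\bigcup_{i=1}^3\mathcal{C}_i\}$; $\mathcal{B}_4=\{D\cup\{a,b,d\}: D\in\bigcup_{i=1}^3\mathcal{D}_i\}$; $\mathcal{B}_5=\{E\cup\{c,d\}: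 E\in\bigcup_{i=1}^3\mathcal{E}_i\}$. Then $(X\cup\{b,c,d\},\bigcup_{i=1}^5\mathcal{B}_i)$ is a $(v+3,k,4,6)$ cover.
   Context: A $(v,k,t,m)$ cover (lotto design) is a pair $(X,\mathcal{B})$ where $X$ is a set of $v$ points and $\mathcal{B}$ is a collection of $k$-subsets of $X$ (blocks) such that every $m$-subset of $X$ meets at least one block in at least $t$ points. A $(v,k,t)$ covering design is a $(v,k,t,t)$ cover, i.e. every $t$-subset of $X$ is contained in some block. -}

module Defs where

open import Data.Nat using (ℕ; _≤_; _∸_)
open import Data.Bool using (Bool; true; false)
open import Data.Bool.Properties using () renaming (_≟_ to _≟ᵇ_)
open import Data.Fin using (Fin)
open import Data.Fin.Subset using (Subset; _∩_; _∪_; _⊆_; ∣_∣; _-_; ⁅_⁆; ∁; ⋃; Empty; Nonempty)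
open import Data.Fin.Subset.Properties using (_∈?_)
open import Data.Vec using (_∷_)
open import Data.Vec.Properties using (≡-dec)
open import Data.List using (List; []; _∷_; map; filter; concatMap; length; deduplicate; _++_)
open import Data.List.Relation.Unary.All using (All)
open import Data.List.Relation.Unary.Any using (Any)
open import Data.List.Relation.Unary.AllPairs using (AllPairs)
open import Data.Product using (_×_)
open import Relation.Binary.PropositionalEquality using (_≡_)
open import Relation.Nullary using (Dec)
open import Data.Nat using (_+_)

_≟ₛ_ : ∀ {v} (p q : Subset v) → Dec (p ≡ q)
_≟ₛ_ = ≡-dec _≟ᵇ_

IsCover : (v k t m : ℕ) → List (Subset v) → Set
IsCover v k t m 𝓑 =
  All (λ B → ∣ B ∣ ≡ k) 𝓑 ×
  ((S : Subset v) → ∣ S ∣ ≡ m → Any (λ B → t ≤ ∣ S ∩ B ∣) 𝓑)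

IsCoveringDesign : ∀ {v} (V : Subset v) (k t : ℕ) → List (Subset v) → Set
IsCoveringDesign {v} V k t 𝒞 =
  All (λ C → (C ⊆ V) × (∣ C ∣ ≡ k)) 𝒞 ×
  ((T : Subset v) → T ⊆ V → ∣ T ∣ ≡ t → Any (λ C → T ⊆ C) 𝒞)

IsPartitionOf : ∀ {v} → Subset v → List (Subset v) → Set
IsPartitionOf S ps =
  All Nonempty ps × AllPairs (λ p q → Empty (p ∩ q)) ps × (⋃ ps ≡ S)

𝓑at : ∀ {v} → List (Subset v) → Fin v → List (Subset v)
𝓑at 𝓑 x = map (λ B → B - x) (filter (λ B → x ∈? B) 𝓑)

∣𝓑at∣ : ∀ {v} → List (Subset v) → Fin v → ℕ
∣𝓑at∣ 𝓑 x = length (deduplicate _≟ₛ_ (𝓑at 𝓑 x))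

-- New point set X ∪ {b,c,d} is Fin (3 + v): a subset of it is written
-- β ∷ γ ∷ δ ∷ S, where β, γ, δ say whether b, c, d belong to it and S ⊆ X.
ext : ∀ {v} → Bool → Bool → Bool → Subset v → Subset (3 + v)
ext β γ δ S = β ∷ γ ∷ δ ∷ S

𝓑₁ : ∀ {v} → List (Subset v) → List (Subset (3 + v))
𝓑₁ 𝓑 = map (ext false false false) 𝓑

𝓑₂ : ∀ {v} → List (Subset v) → Fin v → List (Subset (3 + v))
𝓑₂ 𝓑 a = concatMap
  (λ B → ext true false false B ∷ ext false true false B ∷ ext false false true B ∷ [])
  (𝓑at 𝓑 a)

𝓑₃ : ∀ {v} → Fin v → List (Subset v) → List (Subset (3 + v))
𝓑₃ a 𝒞 = map (λ C → ext true true false (C ∪ ⁅ a ⁆)) 𝒞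

𝓑₄ : ∀ {v} → Fin v → List (Subset v) → List (Subset (3 + v))
𝓑₄ a 𝒟 = map (λ D → ext true false true (D ∪ ⁅ a ⁆)) 𝒟

𝓑₅ : ∀ {v} → List (Subset v) → List (Subset (3 + v))
𝓑₅ ℰ = map (ext false true true) ℰ

module Submission where

-- For coverage, write a 6-set of the
-- new point set as (new points of S) ∪ S′ with S′ ⊆ X and split on which of
-- b, c, d lie in S and on whether a ∈ S′:
--   * no new point: S′ is a 6-set of X, covered by 𝓑 itself;
--   * one new point p and a ∉ S′: the old block B meeting S′ ∪ {a} in four
--     points either avoids a, or B ∖ {a} ∪ {p} meets S in four points;
--   * otherwise a block C ∪ {a,…} or E ∪ {c,d} works, where C or E is a block
--     of one of the pair-covering designs, found by pigeonhole: the points of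
--     S′ ∖ {a} fall into the six cells X_ij, and each of the three systems
--     𝒞, 𝒟, ℰ groups the cells into three classes (a perfect matching of the
--     cells), each carrying a covering design of strength two.

open import Data.Nat using (ℕ; zero; suc; _≤_; _<_; _+_; _*_; _∸_; z≤n; s≤s)
open import Data.Nat.Properties
open import Data.Nat.Tactic.RingSolver using (solve-∀)
open import Data.Bool using (true; false)
open import Data.Fin using (Fin; zero; suc; #_) renaming (_≟_ to _≟ᶠ_)
open import Data.Fin.Subset
open import Data.Fin.Subset.Properties
open import Data.Vec using ([]; _∷_; here; there)
open import Data.List as List using (List; []; _∷_; _++_; lookup; length)
open import Data.Nat.ListAction using (sum)
open import Data.List.Relation.Unary.All as All using (All; []; _∷_)
open import Data.List.Relation.Unary.All.Properties as AllP using (all-filter)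
open import Data.List.Relation.Unary.AllPairs using ([]; _∷_)
open import Data.List.Relation.Unary.Any as Any using (Any)
open import Data.List.Relation.Unary.Any.Properties using (++⁺ˡ; ++⁺ʳ; map⁺; concat⁺)
open import Data.List.Membership.Propositional using (find; lose) renaming (_∈_ to _∈ₗ_)
open import Data.List.Membership.Propositional.Properties using (∈-map⁺; ∈-filter⁺)
open import Data.Product using (Σ-syntax; _×_; _,_; proj₁; proj₂; map₁)
open import Data.Sum using (_⊎_; inj₁; inj₂; [_,_]′; map)
open import Data.Empty using (⊥-elim)
open import Function using (id; _∘′_)
open import Relation.Nullary using (yes; no; contradiction)
open import Relation.Binary.PropositionalEquality
open import Defs

private variable
  n m t : ℕ

-- Counting points of finite subsets

Empty-tail : ∀ {x} {p : Subset n} → Empty (x ∷ p) → Empty p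
Empty-tail e (i , i∈p) = e (suc i , there i∈p)

∣∩∪∣≤ : (S P Q : Subset n) → ∣ S ∩ (P ∪ Q) ∣ ≤ ∣ S ∩ P ∣ + ∣ S ∩ Q ∣
∣∩∪∣≤ [] [] [] = z≤n
∣∩∪∣≤ (false ∷ S) (_ ∷ P) (_ ∷ Q) = ∣∩∪∣≤ S P Q
∣∩∪∣≤ (true ∷ S) (true ∷ P) (q ∷ Q) =
  s≤s (≤-trans (∣∩∪∣≤ S P Q) (+-monoʳ-≤ _ (∣p∣≤∣x∷p∣ q (S ∩ Q))))
∣∩∪∣≤ (true ∷ S) (false ∷ P) (true ∷ Q) =
  ≤-trans (s≤s (∣∩∪∣≤ S P Q)) (≤-reflexive (sym (+-suc _ _)))
∣∩∪∣≤ (true ∷ S) (false ∷ P) (false ∷ Q) = ∣∩∪∣≤ S P Q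

∣∩∪∣≡ : (S P Q : Subset n) → Empty (P ∩ Q) → ∣ S ∩ (P ∪ Q) ∣ ≡ ∣ S ∩ P ∣ + ∣ S ∩ Q ∣
∣∩∪∣≡ [] [] [] _ = refl
∣∩∪∣≡ (_ ∷ S) (true ∷ P) (true ∷ Q) e = ⊥-elim (e (zero , here))
∣∩∪∣≡ (false ∷ S) (_ ∷ P) (_ ∷ Q) e = ∣∩∪∣≡ S P Q (Empty-tail e)
∣∩∪∣≡ (true ∷ S) (true ∷ P) (false ∷ Q) e = cong suc (∣∩∪∣≡ S P Q (Empty-tail e))
∣∩∪∣≡ (true ∷ S) (false ∷ P) (true ∷ Q) e =
  trans (cong suc (∣∩∪∣≡ S P Q (Empty-tail e))) (sym (+-suc _ _))
∣∩∪∣≡ (true ∷ S) (false ∷ P) (false ∷ Q) e = ∣∩∪∣≡ S P Q (Empty-tail e)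

∣⊤∩∣ : (P : Subset n) → ∣ ⊤ ∩ P ∣ ≡ ∣ P ∣
∣⊤∩∣ P = cong ∣_∣ (∩-identityˡ P)

∣∪∣≤ : (P Q : Subset n) → ∣ P ∪ Q ∣ ≤ ∣ P ∣ + ∣ Q ∣
∣∪∣≤ P Q = subst₂ _≤_ (∣⊤∩∣ (P ∪ Q)) (cong₂ _+_ (∣⊤∩∣ P) (∣⊤∩∣ Q)) (∣∩∪∣≤ ⊤ P Q)

∣∪∣≡ : (P Q : Subset n) → Empty (P ∩ Q) → ∣ P ∪ Q ∣ ≡ ∣ P ∣ + ∣ Q ∣
∣∪∣≡ P Q e = subst₂ _≡_ (∣⊤∩∣ (P ∪ Q)) (cong₂ _+_ (∣⊤∩∣ P) (∣⊤∩∣ Q)) (∣∩∪∣≡ ⊤ P Q e)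

∣∣≤∣∩∣+∣∩∁∣ : (S K : Subset n) → ∣ S ∣ ≤ ∣ S ∩ K ∣ + ∣ S ∩ ∁ K ∣
∣∣≤∣∩∣+∣∩∁∣ S K = subst (λ U → ∣ U ∣ ≤ ∣ S ∩ K ∣ + ∣ S ∩ ∁ K ∣) S∩⊤≡S (∣∩∪∣≤ S K (∁ K))
  where
  S∩⊤≡S : S ∩ (K ∪ ∁ K) ≡ S
  S∩⊤≡S = trans (cong (S ∩_) (∪-inverseʳ K)) (∩-identityʳ S)

∣∩⋃∣≤ : (S : Subset n) (ps : List (Subset n)) →
        ∣ S ∩ ⋃ ps ∣ ≤ sum (List.map (λ P → ∣ S ∩ P ∣) ps)
∣∩⋃∣≤ {n} S [] = ≤-reflexive (trans (cong ∣_∣ (∩-zeroʳ S)) (∣⊥∣≡0 n))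
∣∩⋃∣≤ S (P ∷ ps) = ≤-trans (∣∩∪∣≤ S P (⋃ ps)) (+-monoʳ-≤ _ (∣∩⋃∣≤ S ps))

∣∩∣-mono : (S : Subset n) {P Q : Subset n} → P ⊆ Q → ∣ S ∩ P ∣ ≤ ∣ S ∩ Q ∣
∣∩∣-mono S {P} P⊆Q = p⊆q⇒∣p∣≤∣q∣ λ x∈ →
  let x∈S , x∈P = x∈p∩q⁻ S P x∈ in x∈p∩q⁺ (x∈S , P⊆Q x∈P)

⁅⁆-disjoint : ∀ {x : Fin n} {C} → x ∉ C → Empty (C ∩ ⁅ x ⁆)
⁅⁆-disjoint {x = x} {C} x∉C (y , y∈) =
  let y∈C , y∈⁅x⁆ = x∈p∩q⁻ C ⁅ x ⁆ y∈ in x∉C (subst (_∈ C) (x∈⁅y⁆⇒x≡y x y∈⁅x⁆) y∈C)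

∣∩⁅⁆∣≤1 : (S : Subset n) (x : Fin n) → ∣ S ∩ ⁅ x ⁆ ∣ ≤ 1
∣∩⁅⁆∣≤1 S x = ≤-trans (∣p∩q∣≤∣q∣ S ⁅ x ⁆) (≤-reflexive (∣⁅x⁆∣≡1 x))

∈⇒∣∩⁅⁆∣≥1 : ∀ {x : Fin n} {S} → x ∈ S → 1 ≤ ∣ S ∩ ⁅ x ⁆ ∣
∈⇒∣∩⁅⁆∣≥1 {x = x} {S} x∈S = ≤-trans (≤-reflexive (sym (∣⁅x⁆∣≡1 x))) (p⊆q⇒∣p∣≤∣q∣ λ y∈⁅x⁆ →
  x∈p∩q⁺ (subst (_∈ S) (sym (x∈⁅y⁆⇒x≡y x y∈⁅x⁆)) x∈S , y∈⁅x⁆))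

∉⇒∣∩⁅⁆∣≡0 : ∀ {x : Fin n} {S} → x ∉ S → ∣ S ∩ ⁅ x ⁆ ∣ ≡ 0
∉⇒∣∩⁅⁆∣≡0 {n} {x} {S} x∉S = n≤0⇒n≡0 (≤-trans
  (p⊆q⇒∣p∣≤∣q∣ {p = S ∩ ⁅ x ⁆} {⊥} λ y∈ → ⊥-elim (⁅⁆-disjoint x∉S (_ , y∈)))
  (≤-reflexive (∣⊥∣≡0 n)))

∣∪⁅⁆∣ : ∀ {x : Fin n} {C} → x ∉ C → ∣ C ∪ ⁅ x ⁆ ∣ ≡ suc ∣ C ∣
∣∪⁅⁆∣ {x = x} {C} x∉C = begin
  ∣ C ∪ ⁅ x ⁆ ∣     ≡⟨ ∣∪∣≡ C ⁅ x ⁆ (⁅⁆-disjoint x∉C) ⟩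
  ∣ C ∣ + ∣ ⁅ x ⁆ ∣ ≡⟨ cong (∣ C ∣ +_) (∣⁅x⁆∣≡1 x) ⟩
  ∣ C ∣ + 1         ≡⟨ +-comm ∣ C ∣ 1 ⟩
  suc ∣ C ∣         ∎
  where open ≡-Reasoning

∣-∣ : (x : Fin n) (B : Subset n) → x ∈ B → suc ∣ B - x ∣ ≡ ∣ B ∣
∣-∣ zero    (true ∷ B)  here      = cong (suc ∘′ ∣_∣) (p─⊥≡p B)
∣-∣ (suc x) (true ∷ B)  (there m) = cong suc (∣-∣ x B m)
∣-∣ (suc x) (false ∷ B) (there m) = ∣-∣ x B m

adjoin-∣∩∣ : ∀ (S : Subset n) {x C} → x ∈ S → x ∉ C → suc ∣ S ∩ C ∣ ≤ ∣ S ∩ (C ∪ ⁅ x ⁆) ∣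
adjoin-∣∩∣ S {x} {C} x∈S x∉C = begin
  suc ∣ S ∩ C ∣                ≡⟨ +-comm 1 _ ⟩
  ∣ S ∩ C ∣ + 1                ≤⟨ +-monoʳ-≤ _ (∈⇒∣∩⁅⁆∣≥1 x∈S) ⟩
  ∣ S ∩ C ∣ + ∣ S ∩ ⁅ x ⁆ ∣    ≡⟨ ∣∩∪∣≡ S C ⁅ x ⁆ (⁅⁆-disjoint x∉C) ⟨
  ∣ S ∩ (C ∪ ⁅ x ⁆) ∣          ∎
  where open ≤-Reasoning

adjoin-split : (S B : Subset n) (x : Fin n) → (S ∪ ⁅ x ⁆) ∩ B ⊆ (B ∩ ⁅ x ⁆) ∪ (S ∩ (B - x))
adjoin-split S B x {y} y∈ with x∈p∩q⁻ (S ∪ ⁅ x ⁆) B y∈ | y ≟ᶠ x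
... | _ , y∈B     | yes refl = x∈p∪q⁺ (inj₁ (x∈p∩q⁺ (y∈B , x∈⁅x⁆ y)))
... | y∈S∪x , y∈B | no y≢x   = x∈p∪q⁺ (inj₂ (x∈p∩q⁺ (y∈S , x∈p∧x≢y⇒x∈p-y y∈B y≢x)))
  where
  y∈S : y ∈ S
  y∈S = [ id , (λ y∈⁅x⁆ → contradiction (x∈⁅y⁆⇒x≡y x y∈⁅x⁆) y≢x) ]′ (x∈p∪q⁻ S ⁅ x ⁆ y∈S∪x)

adjoin-∣∩∣≤ : (S B : Subset n) (x : Fin n) →
              ∣ (S ∪ ⁅ x ⁆) ∩ B ∣ ≤ ∣ B ∩ ⁅ x ⁆ ∣ + ∣ S ∩ (B - x) ∣
adjoin-∣∩∣≤ S B x = ≤-trans (p⊆q⇒∣p∣≤∣q∣ (adjoin-split S B x)) (∣∪∣≤ (B ∩ ⁅ x ⁆) (S ∩ (B - x)))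

nonempty⇒∣∣≥1 : {P : Subset n} → Nonempty P → 1 ≤ ∣ P ∣
nonempty⇒∣∣≥1 {P = P} (x , x∈P) = ≤-trans (≤-reflexive (sym (∣⁅x⁆∣≡1 x)))
  (p⊆q⇒∣p∣≤∣q∣ λ y∈⁅x⁆ → subst (_∈ P) (sym (x∈⁅y⁆⇒x≡y x y∈⁅x⁆)) x∈P)

∣∪∣≥2 : {P Q : Subset n} → Nonempty P → Nonempty Q → Empty (P ∩ Q) → 2 ≤ ∣ P ∪ Q ∣
∣∪∣≥2 {P = P} {Q} P≠∅ Q≠∅ P∩Q=∅ = ≤-trans (+-mono-≤ (nonempty⇒∣∣≥1 P≠∅) (nonempty⇒∣∣≥1 Q≠∅))
                                         (≤-reflexive (sym (∣∪∣≡ P Q P∩Q=∅)))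

lookup⊆⋃ : (ps : List (Subset n)) (i : Fin (length ps)) → lookup ps i ⊆ ⋃ ps
lookup⊆⋃ (P ∷ ps) zero    = p⊆p∪q (⋃ ps)
lookup⊆⋃ (P ∷ ps) (suc i) = λ x∈ → q⊆p∪q P (⋃ ps) (lookup⊆⋃ ps i x∈)

extend : (T V : Subset n) (m : ℕ) → T ⊆ V → ∣ T ∣ ≤ m → m ≤ ∣ V ∣ →
         Σ[ T′ ∈ Subset n ] T ⊆ T′ × T′ ⊆ V × ∣ T′ ∣ ≡ m
extend [] [] zero _ _ _ = [] , id , id , refl
extend (true ∷ T) (false ∷ V) m T⊆V _ _ with () ← T⊆V here
extend (false ∷ T) (false ∷ V) m T⊆V ∣T∣≤m m≤∣V∣ =
  let T′ , T⊆T′ , T′⊆V , ∣T′∣≡m = extend T V m (drop-∷-⊆ T⊆V) ∣T∣≤m m≤∣V∣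
  in false ∷ T′ , s⊆s T⊆T′ , s⊆s T′⊆V , ∣T′∣≡m
extend (true ∷ T) (true ∷ V) (suc m) T⊆V (s≤s ∣T∣≤m) (s≤s m≤∣V∣) =
  let T′ , T⊆T′ , T′⊆V , ∣T′∣≡m = extend T V m (drop-∷-⊆ T⊆V) ∣T∣≤m m≤∣V∣
  in true ∷ T′ , s⊆s T⊆T′ , s⊆s T′⊆V , cong suc ∣T′∣≡m
extend (false ∷ T) (true ∷ V) m T⊆V ∣T∣≤m m≤1+∣V∣ with m ≤? ∣ V ∣
... | yes m≤∣V∣ =
  let T′ , T⊆T′ , T′⊆V , ∣T′∣≡m = extend T V m (drop-∷-⊆ T⊆V) ∣T∣≤m m≤∣V∣
  in false ∷ T′ , s⊆s T⊆T′ , out⊆ T′⊆V , ∣T′∣≡m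
... | no m≰∣V∣ with m | m≤1+∣V∣
...   | zero  | _         = contradiction z≤n m≰∣V∣
...   | suc m | s≤s m≤∣V∣ =
  let ∣T∣≤m = ≤-trans (p⊆q⇒∣p∣≤∣q∣ (drop-∷-⊆ T⊆V)) (≤-pred (≰⇒> m≰∣V∣))
      T′ , T⊆T′ , T′⊆V , ∣T′∣≡m = extend T V m (drop-∷-⊆ T⊆V) ∣T∣≤m m≤∣V∣
  in true ∷ T′ , out⊆ T⊆T′ , s⊆s T′⊆V , cong suc ∣T′∣≡m

-- Pigeonhole arithmetic

pigeonhole : ∀ t x y z → 3 * t < x + y + z → t < x ⊎ t < y ⊎ t < z
pigeonhole t x y z big with t <? x | t <? y | t <? z
... | yes t<x | _       | _       = inj₁ t<x
... | no _    | yes t<y | _       = inj₂ (inj₁ t<y)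
... | no _    | no _    | yes t<z = inj₂ (inj₂ t<z)
... | no t≮x  | no t≮y  | no t≮z  = contradiction big (≤⇒≯ (begin
  x + y + z  ≤⟨ +-mono-≤ (+-mono-≤ (≮⇒≥ t≮x) (≮⇒≥ t≮y)) (≮⇒≥ t≮z) ⟩
  t + t + t  ≡⟨ thrice t ⟩
  3 * t      ∎))
  where
  open ≤-Reasoning
  thrice : ∀ t → t + t + t ≡ 3 * t
  thrice = solve-∀

-- The six cell counts p q r s x y (cells X₁₁ X₁₂ X₂₁ X₂₂ X₃₁ X₃₂), regrouped
-- along the classes of the ℰ-, 𝒞- and 𝒟-systems.
regroupE : ∀ p q r s x y → p + (q + (r + (s + (x + (y + 0))))) ≡ (p + q) + (r + s) + (x + y)
regroupE = solve-∀

regroupC : ∀ p q r s x y → p + (q + (r + (s + (x + (y + 0))))) ≡ (p + r) + (q + s) + (x + y)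
regroupC = solve-∀

regroupD : ∀ p q r s x y → p + (q + (r + (s + (x + (y + 0))))) ≡ (p + s) + (q + r) + (x + y)
regroupD = solve-∀

both : ∀ {x y} → 0 < x → 0 < y → 1 < x + y
both = +-mono-≤

-- Two points in the four cells X₁₁ X₁₂ X₂₁ X₂₂ lie in a common class of one of
-- the three systems: every pair of these cells is a class of ℰ, 𝒞 or 𝒟.
fourCells : ∀ p q r s → 2 ≤ p + (q + (r + s)) →
  (1 < p + q ⊎ 1 < r + s) ⊎ (1 < p + r ⊎ 1 < q + s) ⊎ (1 < p + s ⊎ 1 < q + r)
fourCells (suc _) (suc _) _       _       _  = inj₁ (inj₁ (both (s≤s z≤n) (s≤s z≤n)))
fourCells (suc _) zero    (suc _) _       _  = inj₂ (inj₁ (inj₁ (both (s≤s z≤n) (s≤s z≤n))))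
fourCells (suc _) zero    zero    (suc _) _  = inj₂ (inj₂ (inj₁ (both (s≤s z≤n) (s≤s z≤n))))
fourCells (suc _) zero    zero    zero    ≥2 = inj₁ (inj₁ ≥2)
fourCells zero    (suc _) (suc _) _       _  = inj₂ (inj₂ (inj₂ (both (s≤s z≤n) (s≤s z≤n))))
fourCells zero    (suc _) zero    (suc _) _  = inj₂ (inj₁ (inj₂ (both (s≤s z≤n) (s≤s z≤n))))
fourCells zero    (suc _) zero    zero    ≥2 = inj₂ (inj₁ (inj₂ ≥2))
fourCells zero    zero    _       _       ≥2 = inj₁ (inj₂ ≥2)

-- Three points in the six cells: some class of some system holds two of them
-- (either X₃₁ ∪ X₃₂ does, or two points lie in the other four cells).
pairedPoints : ∀ p q r s x y → 3 ≤ p + (q + (r + (s + (x + (y + 0))))) →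
  (1 < p + q ⊎ 1 < r + s ⊎ 1 < x + y) ⊎ (1 < p + r ⊎ 1 < q + s ⊎ 1 < x + y) ⊎
  (1 < p + s ⊎ 1 < q + r ⊎ 1 < x + y)
pairedPoints p q r s x y ≥3 with 1 <? x + y
... | yes 1<x+y = inj₁ (inj₂ (inj₂ 1<x+y))
... | no 1≮x+y  = map widen (map widen widen) (fourCells p q r s (≤-pred (begin
  3                                   ≤⟨ ≥3 ⟩
  p + (q + (r + (s + (x + (y + 0))))) ≡⟨ regroup p q r s x y ⟩
  p + (q + (r + s)) + (x + y)         ≤⟨ +-monoʳ-≤ _ (≮⇒≥ 1≮x+y) ⟩
  p + (q + (r + s)) + 1               ≡⟨ +-comm _ 1 ⟩
  suc (p + (q + (r + s)))             ∎)))
  where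
  open ≤-Reasoning
  regroup : ∀ p q r s x y → p + (q + (r + (s + (x + (y + 0))))) ≡ p + (q + (r + s)) + (x + y)
  regroup = solve-∀
  widen : ∀ {A B C : Set} → A ⊎ B → A ⊎ B ⊎ C
  widen = [ inj₁ , (λ b → inj₂ (inj₁ b)) ]′

-- Pair-covering designs

-- A covering design of strength two on V (with at least two points) has a block
-- containing any t ≤ 2 points of S ∩ V: extend them to a pair inside V.
pairHit : ∀ {V : Subset n} {𝒞} → IsCoveringDesign V m 2 𝒞 → 2 ≤ ∣ V ∣ → t ≤ 2 →
          (S : Subset n) → t ≤ ∣ S ∩ V ∣ → Any (λ C → C ⊆ V × t ≤ ∣ S ∩ C ∣) 𝒞
pairHit {n} {t = t} {V} (blocks , covers) ∣V∣≥2 t≤2 S t≤∣S∩V∣ =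
  let T , _ , T⊆S∩V , ∣T∣≡t = extend ⊥ (S ∩ V) t ⊥⊆ (≤-trans (≤-reflexive (∣⊥∣≡0 n)) z≤n) t≤∣S∩V∣
      T′ , T⊆T′ , T′⊆V , ∣T′∣≡2 = extend T V 2 (λ x∈T → p∩q⊆q S V (T⊆S∩V x∈T))
                                         (≤-trans (≤-reflexive ∣T∣≡t) t≤2) ∣V∣≥2
      C , C∈𝒞 , T′⊆C = find (covers T′ T′⊆V ∣T′∣≡2)
      T⊆S∩C : T ⊆ S ∩ C
      T⊆S∩C x∈T = x∈p∩q⁺ (p∩q⊆p S V (T⊆S∩V x∈T) , T′⊆C (T⊆T′ x∈T))
  in lose C∈𝒞 (proj₁ (All.lookup blocks C∈𝒞) ,
               ≤-trans (≤-reflexive (sym ∣T∣≡t)) (p⊆q⇒∣p∣≤∣q∣ T⊆S∩C))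

-- A class of a system: a pair-covering design with block size m on the union of
-- two disjoint nonempty cells P, Q of a region W.
record ClassDesign {n : ℕ} (W P Q : Subset n) (m : ℕ) (𝒞 : List (Subset n)) : Set where
  constructor classDesign
  field
    design    : IsCoveringDesign (P ∪ Q) m 2 𝒞
    nonemptyP : Nonempty P
    nonemptyQ : Nonempty Q
    disjoint  : Empty (P ∩ Q)
    insideP   : P ⊆ W
    insideQ   : Q ⊆ W

  within : ∀ {C} → C ⊆ P ∪ Q → C ⊆ W
  within C⊆P∪Q x∈C = [ insideP , insideQ ]′ (x∈p∪q⁻ P Q (C⊆P∪Q x∈C))

  blocks : All (λ C → C ⊆ W × ∣ C ∣ ≡ m) 𝒞
  blocks = All.map (map₁ within) (proj₁ design)

  hit : t ≤ 2 → (S : Subset n) → t ≤ ∣ S ∩ P ∣ + ∣ S ∩ Q ∣ →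
        Any (λ C → C ⊆ W × t ≤ ∣ S ∩ C ∣) 𝒞
  hit t≤2 S t≤ = Any.map (map₁ within)
    (pairHit design (∣∪∣≥2 nonemptyP nonemptyQ disjoint) t≤2 S
             (≤-trans t≤ (≤-reflexive (sym (∣∩∪∣≡ S P Q disjoint)))))

systemBlocks : ∀ {W P₁ Q₁ P₂ Q₂ P₃ Q₃ : Subset n} {𝒞₁ 𝒞₂ 𝒞₃} →
  ClassDesign W P₁ Q₁ m 𝒞₁ → ClassDesign W P₂ Q₂ m 𝒞₂ → ClassDesign W P₃ Q₃ m 𝒞₃ →
  All (λ C → C ⊆ W × ∣ C ∣ ≡ m) (𝒞₁ ++ 𝒞₂ ++ 𝒞₃)
systemBlocks d₁ d₂ d₃ =
  AllP.++⁺ (ClassDesign.blocks d₁) (AllP.++⁺ (ClassDesign.blocks d₂) (ClassDesign.blocks d₃))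

systemHit : ∀ {W P₁ Q₁ P₂ Q₂ P₃ Q₃ : Subset n} {𝒞₁ 𝒞₂ 𝒞₃} →
  ClassDesign W P₁ Q₁ m 𝒞₁ → ClassDesign W P₂ Q₂ m 𝒞₂ → ClassDesign W P₃ Q₃ m 𝒞₃ →
  t ≤ 1 → (S : Subset n) →
  t < ∣ S ∩ P₁ ∣ + ∣ S ∩ Q₁ ∣ ⊎ t < ∣ S ∩ P₂ ∣ + ∣ S ∩ Q₂ ∣ ⊎ t < ∣ S ∩ P₃ ∣ + ∣ S ∩ Q₃ ∣ →
  Any (λ C → C ⊆ W × suc t ≤ ∣ S ∩ C ∣) (𝒞₁ ++ 𝒞₂ ++ 𝒞₃)
systemHit {𝒞₁ = 𝒞₁} {𝒞₂} d₁ d₂ d₃ t≤1 S =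
  [ (λ h → ++⁺ˡ (ClassDesign.hit d₁ (s≤s t≤1) S h))
  , [ (λ h → ++⁺ʳ 𝒞₁ (++⁺ˡ (ClassDesign.hit d₂ (s≤s t≤1) S h)))
    , (λ h → ++⁺ʳ 𝒞₁ (++⁺ʳ 𝒞₂ (ClassDesign.hit d₃ (s≤s t≤1) S h))) ]′ ]′

-- The construction

module Construction
  {v k : ℕ} (k≥5 : 5 ≤ k) {𝓑 : List (Subset v)} (cover : IsCover v k 4 6 𝓑) (a : Fin v)
  {X₁₁ X₁₂ X₂₁ X₂₂ X₃₁ X₃₂ : Subset v}
  (union : ⋃ (X₁₁ ∷ X₁₂ ∷ X₂₁ ∷ X₂₂ ∷ X₃₁ ∷ X₃₂ ∷ []) ≡ ∁ ⁅ a ⁆)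
  (n₁₁ : Nonempty X₁₁) (n₁₂ : Nonempty X₁₂) (n₂₁ : Nonempty X₂₁)
  (n₂₂ : Nonempty X₂₂) (n₃₁ : Nonempty X₃₁) (n₃₂ : Nonempty X₃₂)
  (e₁₁₋₁₂ : Empty (X₁₁ ∩ X₁₂)) (e₁₁₋₂₁ : Empty (X₁₁ ∩ X₂₁)) (e₁₁₋₂₂ : Empty (X₁₁ ∩ X₂₂))
  (e₁₂₋₂₁ : Empty (X₁₂ ∩ X₂₁)) (e₁₂₋₂₂ : Empty (X₁₂ ∩ X₂₂)) (e₂₁₋₂₂ : Empty (X₂₁ ∩ X₂₂))
  (e₃₁₋₃₂ : Empty (X₃₁ ∩ X₃₂))
  {𝒞₁ 𝒞₂ 𝒞₃ 𝒟₁ 𝒟₂ 𝒟₃ ℰ₁ ℰ₂ ℰ₃ : List (Subset v)}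
  (C₁ : IsCoveringDesign (X₁₁ ∪ X₂₁) (k ∸ 3) 2 𝒞₁) (C₂ : IsCoveringDesign (X₁₂ ∪ X₂₂) (k ∸ 3) 2 𝒞₂)
  (C₃ : IsCoveringDesign (X₃₁ ∪ X₃₂) (k ∸ 3) 2 𝒞₃) (D₁ : IsCoveringDesign (X₁₁ ∪ X₂₂) (k ∸ 3) 2 𝒟₁)
  (D₂ : IsCoveringDesign (X₁₂ ∪ X₂₁) (k ∸ 3) 2 𝒟₂) (D₃ : IsCoveringDesign (X₃₁ ∪ X₃₂) (k ∸ 3) 2 𝒟₃)
  (E₁ : IsCoveringDesign (X₁₁ ∪ X₁₂) (k ∸ 2) 2 ℰ₁) (E₂ : IsCoveringDesign (X₂₁ ∪ X₂₂) (k ∸ 2) 2 ℰ₂)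
  (E₃ : IsCoveringDesign (X₃₁ ∪ X₃₂) (k ∸ 2) 2 ℰ₃)
  where

  cells : List (Subset v)
  cells = X₁₁ ∷ X₁₂ ∷ X₂₁ ∷ X₂₂ ∷ X₃₁ ∷ X₃₂ ∷ []

  𝒞s 𝒟s ℰs : List (Subset v)
  𝒞s = 𝒞₁ ++ 𝒞₂ ++ 𝒞₃
  𝒟s = 𝒟₁ ++ 𝒟₂ ++ 𝒟₃
  ℰs = ℰ₁ ++ ℰ₂ ++ ℰ₃

  tri : Subset v → List (Subset (3 + v))
  tri B = ext true false false B ∷ ext false true false B ∷ ext false false true B ∷ []

  L : List (Subset (3 + v))
  L = 𝓑₁ 𝓑 ++ 𝓑₂ 𝓑 a ++ 𝓑₃ a 𝒞s ++ 𝓑₄ a 𝒟s ++ 𝓑₅ ℰs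

  cell⊆ : (i : Fin 6) → lookup cells i ⊆ ∁ ⁅ a ⁆
  cell⊆ i = subst (lookup cells i ⊆_) union (lookup⊆⋃ cells i)

  avoids : ∀ {C} → C ⊆ ∁ ⁅ a ⁆ → a ∉ C
  avoids C⊆ a∈C = x∈∁p⇒x∉p (C⊆ a∈C) (x∈⁅x⁆ a)

  𝐂₁ : ClassDesign (∁ ⁅ a ⁆) X₁₁ X₂₁ (k ∸ 3) 𝒞₁
  𝐂₁ = classDesign C₁ n₁₁ n₂₁ e₁₁₋₂₁ (cell⊆ (# 0)) (cell⊆ (# 2))
  𝐂₂ : ClassDesign (∁ ⁅ a ⁆) X₁₂ X₂₂ (k ∸ 3) 𝒞₂
  𝐂₂ = classDesign C₂ n₁₂ n₂₂ e₁₂₋₂₂ (cell⊆ (# 1)) (cell⊆ (# 3))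
  𝐂₃ : ClassDesign (∁ ⁅ a ⁆) X₃₁ X₃₂ (k ∸ 3) 𝒞₃
  𝐂₃ = classDesign C₃ n₃₁ n₃₂ e₃₁₋₃₂ (cell⊆ (# 4)) (cell⊆ (# 5))
  𝐃₁ : ClassDesign (∁ ⁅ a ⁆) X₁₁ X₂₂ (k ∸ 3) 𝒟₁
  𝐃₁ = classDesign D₁ n₁₁ n₂₂ e₁₁₋₂₂ (cell⊆ (# 0)) (cell⊆ (# 3))
  𝐃₂ : ClassDesign (∁ ⁅ a ⁆) X₁₂ X₂₁ (k ∸ 3) 𝒟₂
  𝐃₂ = classDesign D₂ n₁₂ n₂₁ e₁₂₋₂₁ (cell⊆ (# 1)) (cell⊆ (# 2))
  𝐃₃ : ClassDesign (∁ ⁅ a ⁆) X₃₁ X₃₂ (k ∸ 3) 𝒟₃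
  𝐃₃ = classDesign D₃ n₃₁ n₃₂ e₃₁₋₃₂ (cell⊆ (# 4)) (cell⊆ (# 5))
  𝐄₁ : ClassDesign (∁ ⁅ a ⁆) X₁₁ X₁₂ (k ∸ 2) ℰ₁
  𝐄₁ = classDesign E₁ n₁₁ n₁₂ e₁₁₋₁₂ (cell⊆ (# 0)) (cell⊆ (# 1))
  𝐄₂ : ClassDesign (∁ ⁅ a ⁆) X₂₁ X₂₂ (k ∸ 2) ℰ₂
  𝐄₂ = classDesign E₂ n₂₁ n₂₂ e₂₁₋₂₂ (cell⊆ (# 2)) (cell⊆ (# 3))
  𝐄₃ : ClassDesign (∁ ⁅ a ⁆) X₃₁ X₃₂ (k ∸ 2) ℰ₃
  𝐄₃ = classDesign E₃ n₃₁ n₃₂ e₃₁₋₃₂ (cell⊆ (# 4)) (cell⊆ (# 5))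

  3+[k∸3]≡k : 3 + (k ∸ 3) ≡ k
  3+[k∸3]≡k = m+[n∸m]≡n (≤-trans (s≤s (s≤s (s≤s z≤n))) k≥5)

  2+[k∸2]≡k : 2 + (k ∸ 2) ≡ k
  2+[k∸2]≡k = m+[n∸m]≡n (≤-trans (s≤s (s≤s z≤n)) k≥5)

  adjoinedSize : ∀ {C} → C ⊆ ∁ ⁅ a ⁆ × ∣ C ∣ ≡ k ∸ 3 → 2 + ∣ C ∪ ⁅ a ⁆ ∣ ≡ k
  adjoinedSize (C⊆ , ∣C∣≡k∸3) =
    trans (cong (2 +_) (∣∪⁅⁆∣ (avoids C⊆))) (trans (cong (3 +_) ∣C∣≡k∸3) 3+[k∸3]≡k)

  plainSize : ∀ {E} → E ⊆ ∁ ⁅ a ⁆ × ∣ E ∣ ≡ k ∸ 2 → 2 + ∣ E ∣ ≡ k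
  plainSize (_ , ∣E∣≡k∸2) = trans (cong (2 +_) ∣E∣≡k∸2) 2+[k∸2]≡k

  derivedSizes : All (λ B → ∣ B ∣ ≡ k) (𝓑₂ 𝓑 a)
  derivedSizes = AllP.concat⁺ (AllP.map⁺ (AllP.map⁺ (All.map derivedSize
    (All.zip (all-filter (a ∈?_) 𝓑 , AllP.filter⁺ (a ∈?_) (proj₁ cover))))))
    where
    derivedSize : ∀ {B} → a ∈ B × ∣ B ∣ ≡ k → All (λ X → ∣ X ∣ ≡ k) (tri (B - a))
    derivedSize {B} (a∈B , ∣B∣≡k) = let e = trans (∣-∣ a B a∈B) ∣B∣≡k in e ∷ e ∷ e ∷ []

  blockSizes : All (λ B → ∣ B ∣ ≡ k) L
  blockSizes = AllP.++⁺ (AllP.map⁺ (proj₁ cover)) (AllP.++⁺ derivedSizes (AllP.++⁺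
    (AllP.map⁺ (All.map adjoinedSize (systemBlocks 𝐂₁ 𝐂₂ 𝐂₃))) (AllP.++⁺
    (AllP.map⁺ (All.map adjoinedSize (systemBlocks 𝐃₁ 𝐃₂ 𝐃₃)))
    (AllP.map⁺ (All.map plainSize (systemBlocks 𝐄₁ 𝐄₂ 𝐄₃))))))

  G : Subset (3 + v) → Set
  G S = Any (λ B → 4 ≤ ∣ S ∩ B ∣) L

  record Derived (S′ : Subset v) : Set where
    constructor derived
    field
      {block}  : Subset v
      member   : block ∈ₗ 𝓑
      contains : a ∈ block
      meets    : 3 ≤ ∣ S′ ∩ (block - a) ∣

  from𝓑₁ : ∀ S → Any (λ B → 4 ≤ ∣ S ∩ ext false false false B ∣) 𝓑 → G S
  from𝓑₁ _ h = ++⁺ˡ (map⁺ h)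

  from𝓑₂ : ∀ S {S′} → (∀ {B} → 3 ≤ ∣ S′ ∩ B ∣ → Any (λ X → 4 ≤ ∣ S ∩ X ∣) (tri B)) →
           Derived S′ → G S
  from𝓑₂ _ add (derived {B} B∈𝓑 a∈B three) = ++⁺ʳ (𝓑₁ 𝓑) (++⁺ˡ (concat⁺ (map⁺
    (lose (∈-map⁺ (_- a) (∈-filter⁺ (a ∈?_) B∈𝓑 a∈B)) (add three)))))

  from𝓑₃ : ∀ S → Any (λ C → 4 ≤ ∣ S ∩ ext true true false (C ∪ ⁅ a ⁆) ∣) 𝒞s → G S
  from𝓑₃ _ h = ++⁺ʳ (𝓑₁ 𝓑) (++⁺ʳ (𝓑₂ 𝓑 a) (++⁺ˡ (map⁺ h)))

  from𝓑₄ : ∀ S → Any (λ D → 4 ≤ ∣ S ∩ ext true false true (D ∪ ⁅ a ⁆) ∣) 𝒟s → G S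
  from𝓑₄ _ h = ++⁺ʳ (𝓑₁ 𝓑) (++⁺ʳ (𝓑₂ 𝓑 a) (++⁺ʳ (𝓑₃ a 𝒞s) (++⁺ˡ (map⁺ h))))

  from𝓑₅ : ∀ S → Any (λ E → 4 ≤ ∣ S ∩ ext false true true E ∣) ℰs → G S
  from𝓑₅ _ h = ++⁺ʳ (𝓑₁ 𝓑) (++⁺ʳ (𝓑₂ 𝓑 a) (++⁺ʳ (𝓑₃ a 𝒞s) (++⁺ʳ (𝓑₄ a 𝒟s) (map⁺ h))))

  shift : ∀ {A : Set} {f : A → ℕ} {xs} j → Any (λ x → m ≤ f x) xs → Any (λ x → j + m ≤ j + f x) xs
  shift j = Any.map (+-monoʳ-≤ j)

  total : Subset v → ℕ
  total S′ = sum (List.map (λ X → ∣ S′ ∩ X ∣) cells)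

  total-bound : (S′ : Subset v) → ∣ S′ ∣ ≤ ∣ S′ ∩ ⁅ a ⁆ ∣ + total S′
  total-bound S′ = ≤-trans (∣∣≤∣∩∣+∣∩∁∣ S′ ⁅ a ⁆)
    (+-monoʳ-≤ _ (subst (λ U → ∣ S′ ∩ U ∣ ≤ total S′) union (∣∩⋃∣≤ S′ cells)))

  countIn : ∀ {S′ m} → a ∈ S′ → ∣ S′ ∣ ≡ suc m → m ≤ total S′
  countIn {S′} a∈S′ ∣S′∣≡1+m = ≤-pred (begin
    suc _                       ≡⟨ ∣S′∣≡1+m ⟨
    ∣ S′ ∣                      ≤⟨ total-bound S′ ⟩
    ∣ S′ ∩ ⁅ a ⁆ ∣ + total S′   ≤⟨ +-monoˡ-≤ (total S′) (∣∩⁅⁆∣≤1 S′ a) ⟩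
    suc (total S′)              ∎)
    where open ≤-Reasoning

  countOut : ∀ {S′ m} → a ∉ S′ → ∣ S′ ∣ ≡ m → m ≤ total S′
  countOut {S′} a∉S′ refl =
    subst (λ e → ∣ S′ ∣ ≤ e + total S′) (∉⇒∣∩⁅⁆∣≡0 a∉S′) (total-bound S′)

  Hit : List (Subset v) → Subset v → ℕ → Set
  Hit 𝒳 S′ m = Any (λ C → C ⊆ ∁ ⁅ a ⁆ × m ≤ ∣ S′ ∩ C ∣) 𝒳

  hit𝒞 : ∀ S′ {t} → t ≤ 1 → 3 * t < total S′ → Hit 𝒞s S′ (suc t)
  hit𝒞 S′ {t} t≤1 big = systemHit 𝐂₁ 𝐂₂ 𝐂₃ t≤1 S′ (pigeonhole t _ _ _
    (subst (3 * t <_) (regroupC (c X₁₁) (c X₁₂) (c X₂₁) (c X₂₂) (c X₃₁) (c X₃₂)) big))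
    where
    c : Subset v → ℕ
    c X = ∣ S′ ∩ X ∣

  hit𝒟 : ∀ S′ {t} → t ≤ 1 → 3 * t < total S′ → Hit 𝒟s S′ (suc t)
  hit𝒟 S′ {t} t≤1 big = systemHit 𝐃₁ 𝐃₂ 𝐃₃ t≤1 S′ (pigeonhole t _ _ _
    (subst (3 * t <_) (regroupD (c X₁₁) (c X₁₂) (c X₂₁) (c X₂₂) (c X₃₁) (c X₃₂)) big))
    where
    c : Subset v → ℕ
    c X = ∣ S′ ∩ X ∣

  hitℰ : ∀ S′ {t} → t ≤ 1 → 3 * t < total S′ → Hit ℰs S′ (suc t)
  hitℰ S′ {t} t≤1 big = systemHit 𝐄₁ 𝐄₂ 𝐄₃ t≤1 S′ (pigeonhole t _ _ _
    (subst (3 * t <_) (regroupE (c X₁₁) (c X₁₂) (c X₂₁) (c X₂₂) (c X₃₁) (c X₃₂)) big))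
    where
    c : Subset v → ℕ
    c X = ∣ S′ ∩ X ∣

  pairSomewhere : ∀ S′ → 3 ≤ total S′ → Hit ℰs S′ 2 ⊎ Hit 𝒞s S′ 2 ⊎ Hit 𝒟s S′ 2
  pairSomewhere S′ ≥3 = map (systemHit 𝐄₁ 𝐄₂ 𝐄₃ ≤-refl S′)
    (map (systemHit 𝐂₁ 𝐂₂ 𝐂₃ ≤-refl S′) (systemHit 𝐃₁ 𝐃₂ 𝐃₃ ≤-refl S′))
    (pairedPoints (c X₁₁) (c X₁₂) (c X₂₁) (c X₂₂) (c X₃₁) (c X₃₂) ≥3)
    where
    c : Subset v → ℕ
    c X = ∣ S′ ∩ X ∣

  adjoinIn : ∀ {S′ m 𝒳} → a ∈ S′ → Hit 𝒳 S′ m → Any (λ C → suc m ≤ ∣ S′ ∩ (C ∪ ⁅ a ⁆) ∣) 𝒳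
  adjoinIn {S′} a∈S′ = Any.map λ (C⊆ , m≤) → ≤-trans (s≤s m≤) (adjoin-∣∩∣ S′ a∈S′ (avoids C⊆))

  adjoinOut : ∀ S′ {m 𝒳} → Hit 𝒳 S′ m → Any (λ C → m ≤ ∣ S′ ∩ (C ∪ ⁅ a ⁆) ∣) 𝒳
  adjoinOut S′ = Any.map λ (_ , m≤) → ≤-trans m≤ (∣∩∣-mono S′ (p⊆p∪q ⁅ a ⁆))

  forget : ∀ S′ {m 𝒳} → Hit 𝒳 S′ m → Any (λ C → m ≤ ∣ S′ ∩ C ∣) 𝒳
  forget _ = Any.map proj₂

  -- Five old points S′ with a ∉ S′: the old block meeting S′ ∪ {a} in four points
  -- either avoids a (and meets S′ in four points) or gives a derived block.
  oldOrDerived : ∀ {S′} → a ∉ S′ → ∣ S′ ∣ ≡ 5 → Any (λ B → 4 ≤ ∣ S′ ∩ B ∣) 𝓑 ⊎ Derived S′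
  oldOrDerived {S′} a∉S′ five
    with find (proj₂ cover (S′ ∪ ⁅ a ⁆) (trans (∣∪⁅⁆∣ a∉S′) (cong suc five)))
  ... | B , B∈𝓑 , four with a ∈? B
  ...   | yes a∈B = inj₂ (derived B∈𝓑 a∈B (≤-pred (begin
    4                                   ≤⟨ four ⟩
    ∣ (S′ ∪ ⁅ a ⁆) ∩ B ∣                ≤⟨ adjoin-∣∩∣≤ S′ B a ⟩
    ∣ B ∩ ⁅ a ⁆ ∣ + ∣ S′ ∩ (B - a) ∣   ≤⟨ +-monoˡ-≤ _ (∣∩⁅⁆∣≤1 B a) ⟩
    suc ∣ S′ ∩ (B - a) ∣                ∎)))
    where open ≤-Reasoning
  ...   | no a∉B = inj₁ (lose B∈𝓑 (begin
    4                                   ≤⟨ four ⟩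
    ∣ (S′ ∪ ⁅ a ⁆) ∩ B ∣                ≤⟨ adjoin-∣∩∣≤ S′ B a ⟩
    ∣ B ∩ ⁅ a ⁆ ∣ + ∣ S′ ∩ (B - a) ∣   ≡⟨ cong (_+ ∣ S′ ∩ (B - a) ∣) (∉⇒∣∩⁅⁆∣≡0 a∉B) ⟩
    ∣ S′ ∩ (B - a) ∣                    ≤⟨ ∣∩∣-mono S′ (p─q⊆p B ⁅ a ⁆) ⟩
    ∣ S′ ∩ B ∣                          ∎))
    where open ≤-Reasoning

  -- The case analysis on the new points of S = β ∷ γ ∷ δ ∷ S′ and on a ∈ S′.
  -- The argument of `shift` is the number of new points shared with the block.
  covers : (S : Subset (3 + v)) → ∣ S ∣ ≡ 6 → G S
  covers S@(false ∷ false ∷ false ∷ S′) six = from𝓑₁ S (proj₂ cover S′ six)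
  covers S@(true ∷ false ∷ false ∷ S′) six with a ∈? S′ | suc-injective six
  ... | no a∉S′  | five = [ from𝓑₁ S , from𝓑₂ S (λ h → Any.here (s≤s h)) ]′
                            (oldOrDerived a∉S′ five)
  ... | yes a∈S′ | five = from𝓑₃ S (shift 1 (adjoinIn a∈S′ (hit𝒞 S′ ≤-refl (countIn a∈S′ five))))
  covers S@(false ∷ true ∷ false ∷ S′) six with a ∈? S′ | suc-injective six
  ... | no a∉S′  | five = [ from𝓑₁ S , from𝓑₂ S (λ h → Any.there (Any.here (s≤s h))) ]′
                            (oldOrDerived a∉S′ five)
  ... | yes a∈S′ | five = from𝓑₃ S (shift 1 (adjoinIn a∈S′ (hit𝒞 S′ ≤-refl (countIn a∈S′ five))))
  covers S@(false ∷ false ∷ true ∷ S′) six with a ∈? S′ | suc-injective six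
  ... | no a∉S′  | five = [ from𝓑₁ S , from𝓑₂ S (λ h → Any.there (Any.there (Any.here (s≤s h)))) ]′
                            (oldOrDerived a∉S′ five)
  ... | yes a∈S′ | five = from𝓑₄ S (shift 1 (adjoinIn a∈S′ (hit𝒟 S′ ≤-refl (countIn a∈S′ five))))
  covers S@(true ∷ true ∷ false ∷ S′) six with a ∈? S′ | suc-injective (suc-injective six)
  ... | no a∉S′  | four = from𝓑₃ S (shift 2 (adjoinOut S′ (hit𝒞 S′ ≤-refl (countOut a∉S′ four))))
  ... | yes a∈S′ | four =
    from𝓑₃ S (shift 2 (adjoinIn a∈S′ (hit𝒞 S′ z≤n (≤-trans (s≤s z≤n) (countIn a∈S′ four)))))
  covers S@(true ∷ false ∷ true ∷ S′) six with a ∈? S′ | suc-injective (suc-injective six)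
  ... | no a∉S′  | four = from𝓑₄ S (shift 2 (adjoinOut S′ (hit𝒟 S′ ≤-refl (countOut a∉S′ four))))
  ... | yes a∈S′ | four =
    from𝓑₄ S (shift 2 (adjoinIn a∈S′ (hit𝒟 S′ z≤n (≤-trans (s≤s z≤n) (countIn a∈S′ four)))))
  covers S@(false ∷ true ∷ true ∷ S′) six with a ∈? S′ | suc-injective (suc-injective six)
  ... | no a∉S′  | four = from𝓑₅ S (shift 2 (forget S′ (hitℰ S′ ≤-refl (countOut a∉S′ four))))
  ... | yes a∈S′ | four =
    [ (λ h → from𝓑₅ S (shift 2 (forget S′ h)))
    , [ (λ h → from𝓑₃ S (shift 1 (adjoinIn a∈S′ h)))
      , (λ h → from𝓑₄ S (shift 1 (adjoinIn a∈S′ h))) ]′ ]′ (pairSomewhere S′ (countIn a∈S′ four))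
  covers S@(true ∷ true ∷ true ∷ S′) six
    with a ∈? S′ | suc-injective (suc-injective (suc-injective six))
  ... | no a∉S′  | three =
    [ (λ h → from𝓑₅ S (shift 2 (forget S′ h)))
    , [ (λ h → from𝓑₃ S (shift 2 (adjoinOut S′ h)))
      , (λ h → from𝓑₄ S (shift 2 (adjoinOut S′ h))) ]′ ]′ (pairSomewhere S′ (countOut a∉S′ three))
  ... | yes a∈S′ | three =
    from𝓑₃ S (shift 2 (adjoinIn a∈S′ (hit𝒞 S′ z≤n (≤-trans (s≤s z≤n) (countIn a∈S′ three)))))

theorem12 : (v k : ℕ) → 5 ≤ k →
    (𝓑 : List (Subset v)) → IsCover v k 4 6 𝓑 →
    (a : Fin v) → ((x : Fin v) → ∣𝓑at∣ 𝓑 a ≤ ∣𝓑at∣ 𝓑 x) →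
    (X₁₁ X₁₂ X₂₁ X₂₂ X₃₁ X₃₂ : Subset v) →
    IsPartitionOf (∁ ⁅ a ⁆) (X₁₁ ∷ X₁₂ ∷ X₂₁ ∷ X₂₂ ∷ X₃₁ ∷ X₃₂ ∷ []) →
    (𝒞₁ 𝒞₂ 𝒞₃ 𝒟₁ 𝒟₂ 𝒟₃ ℰ₁ ℰ₂ ℰ₃ : List (Subset v)) →
    IsCoveringDesign (X₁₁ ∪ X₂₁) (k ∸ 3) 2 𝒞₁ →
    IsCoveringDesign (X₁₂ ∪ X₂₂) (k ∸ 3) 2 𝒞₂ →
    IsCoveringDesign (X₃₁ ∪ X₃₂) (k ∸ 3) 2 𝒞₃ →
    IsCoveringDesign (X₁₁ ∪ X₂₂) (k ∸ 3) 2 𝒟₁ →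
    IsCoveringDesign (X₁₂ ∪ X₂₁) (k ∸ 3) 2 𝒟₂ →
    IsCoveringDesign (X₃₁ ∪ X₃₂) (k ∸ 3) 2 𝒟₃ →
    IsCoveringDesign (X₁₁ ∪ X₁₂) (k ∸ 2) 2 ℰ₁ →
    IsCoveringDesign (X₂₁ ∪ X₂₂) (k ∸ 2) 2 ℰ₂ →
    IsCoveringDesign (X₃₁ ∪ X₃₂) (k ∸ 2) 2 ℰ₃ →
    IsCover (3 + v) k 4 6
      (𝓑₁ 𝓑 ++ 𝓑₂ 𝓑 a ++ 𝓑₃ a (𝒞₁ ++ 𝒞₂ ++ 𝒞₃)
        ++ 𝓑₄ a (𝒟₁ ++ 𝒟₂ ++ 𝒟₃) ++ 𝓑₅ (ℰ₁ ++ ℰ₂ ++ ℰ₃))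
-- The choice of a with the fewest derived blocks only matters for the size of
-- the cover, not for its coverage; of the partition we use the nonempty cells,
-- the disjointness of the cells paired into classes, and the union X ∖ {a}.
theorem12 v k k≥5 𝓑 cover a _ X₁₁ X₁₂ X₂₁ X₂₂ X₃₁ X₃₂
  ( (n₁₁ ∷ n₁₂ ∷ n₂₁ ∷ n₂₂ ∷ n₃₁ ∷ n₃₂ ∷ [])
  , ( (e₁₁₋₁₂ ∷ e₁₁₋₂₁ ∷ e₁₁₋₂₂ ∷ _ ∷ _ ∷ []) ∷ (e₁₂₋₂₁ ∷ e₁₂₋₂₂ ∷ _ ∷ _ ∷ [])
    ∷ (e₂₁₋₂₂ ∷ _ ∷ _ ∷ []) ∷ _ ∷ (e₃₁₋₃₂ ∷ []) ∷ [] ∷ [])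
  , union)
  𝒞₁ 𝒞₂ 𝒞₃ 𝒟₁ 𝒟₂ 𝒟₃ ℰ₁ ℰ₂ ℰ₃ C₁ C₂ C₃ D₁ D₂ D₃ E₁ E₂ E₃ = blockSizes , covers
  where
  open Construction k≥5 cover a union n₁₁ n₁₂ n₂₁ n₂₂ n₃₁ n₃₂
         e₁₁₋₁₂ e₁₁₋₂₁ e₁₁₋₂₂ e₁₂₋₂₁ e₁₂₋₂₂ e₂₁₋₂₂ e₃₁₋₃₂ C₁ C₂ C₃ D₁ D₂ D₃ E₁ E₂ E₃
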